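{- Let $S_n$ be the Sierpiński gasket graph with $n\geq 3$. Then $SPC_{2U}(S_n)\leq 3^{n-2}$.
   Context: The Sierpiński gasket graphs are defined recursively: $S_1=K_3$, whose three vertices are its extreme vertices; $S_{n+1}$ is obtained from three copies $A,B,C$ of $S_n$ with extreme vertices $a_1,a_2,a_3$, $b_1,b_2,b_3$, $c_1,c_2,c_3$ by identifying $a_2$ with $b_1$, $a_3$ with $c_1$, and $b_3$ with $c_2$; the extreme vertices of $S_{n+1}$ are $a_1,b_2,c_3$. For a graph $G$ with distance $d$, a set $S\subseteq V(G)$ is a $2$-shortest path union cover if every edge of $G$ lies on some shortest $u$–$v$ path with $u\in S$ and $d(u,v)\leq 2$; $SPC_{2U}(G)$ is the minimum cardinality of such a set. -}

module Defs where

open import Data.Nat using (ℕ; zero; suc; _≤_; _∸_)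
open import Data.Fin using (Fin; zero; suc)
open import Data.Empty using (⊥)
open import Data.Sum using (_⊎_; inj₁; inj₂)
open import Data.Product using (Σ; _×_; _,_; ∃-syntax)
open import Data.List using (List; length)
open import Data.List.Membership.Propositional using (_∈_)
open import Relation.Binary.PropositionalEquality using (_≡_; _≢_)

record Graph : Set₁ where
  field
    V   : Set
    Adj : V → V → Set
open Graph public

data Walk (G : Graph) : V G → V G → ℕ → Set where
  [_]  : (u : V G) → Walk G u u 0
  _∷_  : ∀ {u w v k} → Adj G u w → Walk G w v k → Walk G u v (suc k)

Dist : (G : Graph) → V G → V G → ℕ → Set
Dist G u v k = Walk G u v k × (∀ j → Walk G u v j → k ≤ j)

data EdgeOn (G : Graph) (x y : V G) : ∀ {u v k} → Walk G u v k → Set where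
  here-xy : ∀ {v k} (a : Adj G x y) (w : Walk G y v k) → EdgeOn G x y (a ∷ w)
  here-yx : ∀ {v k} (a : Adj G y x) (w : Walk G x v k) → EdgeOn G x y (a ∷ w)
  there   : ∀ {u t v k} (a : Adj G u t) {w : Walk G t v k} →
            EdgeOn G x y w → EdgeOn G x y (a ∷ w)

-- A shortest u–v walk (of length d(u,v)) is automatically a path.
-- S is a 2-shortest path union cover: every edge {x,y} lies on some
-- shortest u–v path with u ∈ S and d(u,v) ≤ 2.
Is2SPUCover : (G : Graph) → List (V G) → Set
Is2SPUCover G S =
  ∀ x y → Adj G x y →
    ∃[ u ] ∃[ v ] ∃[ k ] Σ (Walk G u v k) λ w →
      u ∈ S × Dist G u v k × k ≤ 2 × EdgeOn G x y w

-- SPC_{2U}(G) ≤ b : there is a 2-SP union cover of cardinality ≤ b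
-- (a list of length ≤ b; duplicates only increase the length).
SPC2U≤ : (G : Graph) → ℕ → Set
SPC2U≤ G b = Σ (List (V G)) λ S → length S ≤ b × Is2SPUCover G S

-- Index m describes S_{m+1}.  Vertices of S_{m+1}: the three extreme
-- vertices (Fin 3) or a non-extreme ("inner") vertex, Inner m.
-- Inner vertices of S_{m+2} = three junction vertices (junction j is the
-- vertex shared by the two copies other than copy j) or an inner vertex
-- of one of the three copies.

Inner : ℕ → Set
Inner zero    = ⊥
Inner (suc m) = Fin 3 ⊎ (Fin 3 × Inner m)

Vtx : ℕ → Set
Vtx m = Fin 3 ⊎ Inner m

third : Fin 3 → Fin 3 → Fin 3
third zero          (suc zero)    = suc (suc zero)
third (suc zero)    zero          = suc (suc zero)
third zero          (suc (suc zero)) = suc zero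
third (suc (suc zero)) zero       = suc zero
third (suc zero)    (suc (suc zero)) = zero
third (suc (suc zero)) (suc zero) = zero
third _ _ = zero  -- unused (equal indices)

-- extreme vertex j of copy k of S_{m+1} inside S_{m+2}:
-- copies A,B,C = 0,1,2; extreme vertex k of copy k is extreme k of the
-- big graph; otherwise it is the junction of copies k and j
-- (a_2 = b_1, a_3 = c_1, b_3 = c_2, 0-indexed).
embExt : ∀ m → Fin 3 → Fin 3 → Vtx (suc m)
embExt m zero zero = inj₁ zero
embExt m (suc zero) (suc zero) = inj₁ (suc zero)
embExt m (suc (suc zero)) (suc (suc zero)) = inj₁ (suc (suc zero))
embExt m k j = inj₂ (inj₁ (third k j))

emb : ∀ m → Fin 3 → Vtx m → Vtx (suc m)
emb m k (inj₁ j) = embExt m k j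
emb m k (inj₂ x) = inj₂ (inj₂ (k , x))

GAdj : ∀ m → Vtx m → Vtx m → Set
GAdj zero    x y = x ≢ y
GAdj (suc m) u v = ∃[ k ] ∃[ x ] ∃[ y ]
  (GAdj m x y × emb m k x ≡ u × emb m k y ≡ v)

Gasket : ℕ → Graph
Gasket m = record { V = Vtx m ; Adj = GAdj m }

-- S_n for n ≥ 1 (S_0 is junk and never used)
S : ℕ → Graph
S n = Gasket (n ∸ 1)

-- A copy of S_m inside S_{m+1} is an induced subgraph, so distances up to 2
-- within the copy are distances in S_{m+1}; hence 2-SP union covers of the three
-- copies, pushed forward, together cover S_{m+1}.  In S₂ the two extreme
-- vertices other than a corner k already form a cover: every edge either ends
-- at one of them or is the second edge of a geodesic of length 2 from one of
-- them.  In S₃ these pairs, taken in the three copies of S₂ with k the copy's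
-- outer corner, are exactly the three junction vertices, which therefore cover
-- S₃; and three translated copies of a cover of S_n cover S_{n+1}, giving 3^{n-2}.

module Submission where

open import Defs
open import Data.Nat using (ℕ; zero; suc; _+_; _*_; _^_; _∸_; _≤_; z≤n; s≤s)
open import Data.Nat.Properties using (≤-trans; ≤-reflexive; +-identityʳ)
open import Data.Fin using (Fin)
open import Data.Fin.Patterns using (0F; 1F; 2F)
open import Data.Fin.Properties using (_≟_)
open import Data.Empty using (⊥-elim)
open import Data.Sum using (inj₁; inj₂)
open import Data.Sum.Properties using (inj₁-injective)
open import Data.Product using (Σ; _×_; _,_; ∃-syntax)
open import Data.List using (List; []; _∷_; length; map; _++_; allFin)
open import Data.List.Properties using (length-++; length-map)
open import Data.List.Membership.Propositional using (_∈_)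
open import Data.List.Membership.Propositional.Properties
  using (∈-map⁺; ∈-++⁺ˡ; ∈-++⁺ʳ; ∈-allFin)
open import Data.List.Relation.Unary.Any using (here; there)
open import Function using (_∘_)
open import Relation.Nullary using (¬_; yes; no)
open import Relation.Binary.PropositionalEquality
  using (_≡_; _≢_; refl; sym; trans; cong; cong₂; subst; subst₂; ≢-sym; module ≡-Reasoning)

CoveredBy : (G : Graph) → List (V G) → V G → V G → Set
CoveredBy G S x y = ∃[ u ] ∃[ v ] ∃[ k ] Σ (Walk G u v k) λ w →
  u ∈ S × Dist G u v k × k ≤ 2 × EdgeOn G x y w

module _ {G : Graph} where

  walk-length-0 : ∀ {u v} → Walk G u v 0 → u ≡ v
  walk-length-0 [ _ ] = refl

  walk-length-1 : ∀ {u v} → Walk G u v 1 → Adj G u v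
  walk-length-1 (uv ∷ [ _ ]) = uv

  dist-adjacent : ∀ {u v} → Adj G u v → u ≢ v → Dist G u v 1
  dist-adjacent uv u≢v = uv ∷ [ _ ] , λ where
    zero    p → ⊥-elim (u≢v (walk-length-0 p))
    (suc _) _ → s≤s z≤n

  dist-two : ∀ {u w v} → Adj G u w → Adj G w v → u ≢ v → ¬ Adj G u v → Dist G u v 2
  dist-two uw wv u≢v u≁v = uw ∷ (wv ∷ [ _ ]) , λ where
    zero          p → ⊥-elim (u≢v (walk-length-0 p))
    (suc zero)    p → ⊥-elim (u≁v (walk-length-1 p))
    (suc (suc _)) _ → s≤s (s≤s z≤n)

  edgeOn-swap : ∀ {x y u v k} {w : Walk G u v k} → EdgeOn G x y w → EdgeOn G y x w
  edgeOn-swap (here-xy a w) = here-yx a w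
  edgeOn-swap (here-yx a w) = here-xy a w
  edgeOn-swap (there a e)   = there a (edgeOn-swap e)

  covered-sym : ∀ {S x y} → CoveredBy G S x y → CoveredBy G S y x
  covered-sym (u , v , k , w , u∈S , d , k≤2 , xy∈w) = u , v , k , w , u∈S , d , k≤2 , edgeOn-swap xy∈w

  covered-from-endpoint : ∀ {S u v} → u ∈ S → Adj G u v → u ≢ v → CoveredBy G S u v
  covered-from-endpoint u∈S uv u≢v =
    _ , _ , 1 , uv ∷ [ _ ] , u∈S , dist-adjacent uv u≢v , s≤s z≤n , here-xy uv [ _ ]

  covered-from-neighbour : ∀ {S u w v} → u ∈ S → Adj G u w → Adj G w v →
                           u ≢ v → ¬ Adj G u v → CoveredBy G S w v
  covered-from-neighbour u∈S uw wv u≢v u≁v =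
    _ , _ , 2 , uw ∷ (wv ∷ [ _ ]) , u∈S , dist-two uw wv u≢v u≁v , s≤s (s≤s z≤n) ,
    there uw (here-xy wv [ _ ])

record InducedEmbedding (G H : Graph) : Set where
  field
    embed     : V G → V H
    injective : ∀ {x y} → embed x ≡ embed y → x ≡ y
    preserves : ∀ {x y} → Adj G x y → Adj H (embed x) (embed y)
    reflects  : ∀ {x y} → Adj H (embed x) (embed y) → Adj G x y

open InducedEmbedding

module _ {G H : Graph} (f : InducedEmbedding G H) where

  embed-walk : ∀ {u v k} → Walk G u v k → Walk H (embed f u) (embed f v) k
  embed-walk [ u ]   = [ embed f u ]
  embed-walk (a ∷ w) = preserves f a ∷ embed-walk w

  embed-edgeOn : ∀ {x y u v k} {w : Walk G u v k} → EdgeOn G x y w →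
                 EdgeOn H (embed f x) (embed f y) (embed-walk w)
  embed-edgeOn (here-xy a w) = here-xy (preserves f a) (embed-walk w)
  embed-edgeOn (here-yx a w) = here-yx (preserves f a) (embed-walk w)
  embed-edgeOn (there a e)   = there (preserves f a) (embed-edgeOn e)

  -- Only walks of length 0 or 1 could undercut a distance k ≤ 2, and an
  -- induced embedding reflects those.
  embed-dist : ∀ {u v k} → Dist G u v k → k ≤ 2 → Dist H (embed f u) (embed f v) k
  embed-dist {u} {v} (w , shortest) k≤2 = embed-walk w , λ where
    zero          p → shortest 0 (subst (λ z → Walk G u z 0) (injective f (walk-length-0 p)) [ u ])
    (suc zero)    p → shortest 1 (reflects f (walk-length-1 p) ∷ [ v ])
    (suc (suc _)) _ → ≤-trans k≤2 (s≤s (s≤s z≤n))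

  embed-covered : ∀ {S S' x y} → (∀ {u} → u ∈ S → embed f u ∈ S') →
                  CoveredBy G S x y → CoveredBy H S' (embed f x) (embed f y)
  embed-covered S⊆S' (u , v , k , w , u∈S , d , k≤2 , xy∈w) =
    embed f u , embed f v , k , embed-walk w , S⊆S' u∈S , embed-dist d k≤2 , k≤2 , embed-edgeOn xy∈w

cover-from-copies : ∀ {G H : Graph} {I : Set} (copy : I → InducedEmbedding G H) →
  (∀ {x y} → Adj H x y →
     ∃[ i ] ∃[ x' ] ∃[ y' ] (Adj G x' y' × embed (copy i) x' ≡ x × embed (copy i) y' ≡ y)) →
  (S : I → List (V G)) (S' : List (V H)) →
  (∀ i → Is2SPUCover G (S i)) → (∀ i {u} → u ∈ S i → embed (copy i) u ∈ S') →
  Is2SPUCover H S'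
cover-from-copies copy edges-from-copies S S' covers images _ _ xy with edges-from-copies xy
... | i , x' , y' , x'y' , refl , refl = embed-covered (copy i) (images i) (covers i x' y' x'y')

pattern extreme i  = inj₁ i
pattern junction t = inj₂ (inj₁ t)

retract : ∀ m → Fin 3 → Vtx (suc m) → Vtx m
retract m k (extreme i)           = extreme i
retract m k (junction t)          = extreme (third k t)
retract m k (inj₂ (inj₂ (_ , x))) = inj₂ x

retract-emb : ∀ m k x → retract m k (emb m k x) ≡ x
retract-emb m 0F (extreme 0F) = refl
retract-emb m 0F (extreme 1F) = refl
retract-emb m 0F (extreme 2F) = refl
retract-emb m 1F (extreme 0F) = refl
retract-emb m 1F (extreme 1F) = refl
retract-emb m 1F (extreme 2F) = refl
retract-emb m 2F (extreme 0F) = refl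
retract-emb m 2F (extreme 1F) = refl
retract-emb m 2F (extreme 2F) = refl
retract-emb m k  (inj₂ _)     = refl

emb-injective : ∀ m k {x y} → emb m k x ≡ emb m k y → x ≡ y
emb-injective m k {x} {y} e = begin
  x                       ≡⟨ sym (retract-emb m k x) ⟩
  retract m k (emb m k x) ≡⟨ cong (retract m k) e ⟩
  retract m k (emb m k y) ≡⟨ retract-emb m k y ⟩
  y                       ∎
  where open ≡-Reasoning

-- The hypothesis says that emb m k z lies in copy k'; phrasing it through
-- retract leaves only k', k and z to inspect.
retract-shared : ∀ m {k' k} z → k' ≢ k →
  emb m k' (retract m k' (emb m k z)) ≡ emb m k z → retract m k' (emb m k z) ≡ extreme k
retract-shared m {0F} {0F} _ k'≢k _ = ⊥-elim (k'≢k refl)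
retract-shared m {1F} {1F} _ k'≢k _ = ⊥-elim (k'≢k refl)
retract-shared m {2F} {2F} _ k'≢k _ = ⊥-elim (k'≢k refl)
retract-shared m {k = 0F} (extreme 0F) _ _ = refl
retract-shared m {k = 1F} (extreme 1F) _ _ = refl
retract-shared m {k = 2F} (extreme 2F) _ _ = refl
retract-shared m {1F} {0F} (extreme 1F) _ _  = refl
retract-shared m {2F} {0F} (extreme 1F) _ _  = refl
retract-shared m {1F} {0F} (extreme 2F) _ _  = refl
retract-shared m {2F} {0F} (extreme 2F) _ _  = refl
retract-shared m {0F} {1F} (extreme 0F) _ _  = refl
retract-shared m {2F} {1F} (extreme 0F) _ ()
retract-shared m {0F} {1F} (extreme 2F) _ ()
retract-shared m {2F} {1F} (extreme 2F) _ _  = refl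
retract-shared m {0F} {2F} (extreme 0F) _ _  = refl
retract-shared m {1F} {2F} (extreme 0F) _ ()
retract-shared m {0F} {2F} (extreme 1F) _ ()
retract-shared m {1F} {2F} (extreme 1F) _ _  = refl
retract-shared m (inj₂ _) k'≢k refl = ⊥-elim (k'≢k refl)

shared-vertex : ∀ m {k' k} x z → k' ≢ k → emb m k' x ≡ emb m k z → x ≡ extreme k
shared-vertex m {k'} {k} x z k'≢k e = begin
  x                         ≡⟨ sym (retract-emb m k' x) ⟩
  retract m k' (emb m k' x) ≡⟨ cong (retract m k') e ⟩
  retract m k' (emb m k z)  ≡⟨ retract-shared m z k'≢k z-in-copy-k' ⟩
  extreme k                 ∎
  where
  open ≡-Reasoning
  z-in-copy-k' : emb m k' (retract m k' (emb m k z)) ≡ emb m k z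
  z-in-copy-k' = subst (λ v → emb m k' (retract m k' v) ≡ v) e (cong (emb m k') (retract-emb m k' x))

extreme-preimage : ∀ m {k i} x → emb m k x ≡ extreme i → k ≡ i × x ≡ extreme i
extreme-preimage m {0F} (extreme 0F) refl = refl , refl
extreme-preimage m {0F} (extreme 1F) ()
extreme-preimage m {0F} (extreme 2F) ()
extreme-preimage m {1F} (extreme 0F) ()
extreme-preimage m {1F} (extreme 1F) refl = refl , refl
extreme-preimage m {1F} (extreme 2F) ()
extreme-preimage m {2F} (extreme 0F) ()
extreme-preimage m {2F} (extreme 1F) ()
extreme-preimage m {2F} (extreme 2F) refl = refl , refl
extreme-preimage m (inj₂ _) ()

junction-not-in-own-copy : ∀ m {t} x → emb m t x ≢ junction t
junction-not-in-own-copy m {0F} (extreme 0F) ()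
junction-not-in-own-copy m {0F} (extreme 1F) ()
junction-not-in-own-copy m {0F} (extreme 2F) ()
junction-not-in-own-copy m {1F} (extreme 0F) ()
junction-not-in-own-copy m {1F} (extreme 1F) ()
junction-not-in-own-copy m {1F} (extreme 2F) ()
junction-not-in-own-copy m {2F} (extreme 0F) ()
junction-not-in-own-copy m {2F} (extreme 1F) ()
junction-not-in-own-copy m {2F} (extreme 2F) ()
junction-not-in-own-copy m (inj₂ _) ()

adjacent-sym : ∀ m {x y} → GAdj m x y → GAdj m y x
adjacent-sym zero    x≢y                     = ≢-sym x≢y
adjacent-sym (suc m) (k , x , y , xy , ex , ey) = k , y , x , adjacent-sym m xy , ey , ex

adjacent⇒≢ : ∀ m {x y} → GAdj m x y → x ≢ y
adjacent⇒≢ zero    x≢y                           = x≢y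
adjacent⇒≢ (suc m) (k , x , y , xy , refl , refl) = adjacent⇒≢ m xy ∘ emb-injective m k

emb-reflects-adjacency : ∀ m k {x y} → GAdj (suc m) (emb m k x) (emb m k y) → GAdj m x y
emb-reflects-adjacency m k {x} {y} (k' , x' , y' , x'y' , ex , ey) with k' ≟ k
... | yes refl = subst₂ (GAdj m) (emb-injective m k ex) (emb-injective m k ey) x'y'
... | no k'≢k  = ⊥-elim (adjacent⇒≢ m x'y'
                   (trans (shared-vertex m x' x k'≢k ex) (sym (shared-vertex m y' y k'≢k ey))))

copy : ∀ m → Fin 3 → InducedEmbedding (Gasket m) (Gasket (suc m))
copy m k = record
  { embed     = emb m k
  ; injective = emb-injective m k
  ; preserves = λ {x} {y} xy → k , x , y , xy , refl , refl
  ; reflects  = emb-reflects-adjacency m k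
  }

gasket-cover-from-copies : ∀ m (S : Fin 3 → List (Vtx m)) (S' : List (Vtx (suc m))) →
  (∀ k → Is2SPUCover (Gasket m) (S k)) → (∀ k {u} → u ∈ S k → emb m k u ∈ S') →
  Is2SPUCover (Gasket (suc m)) S'
gasket-cover-from-copies m = cover-from-copies (copy m) (λ xy → xy)

extremes-nonadjacent : ∀ m {i j} → ¬ GAdj (suc m) (extreme i) (extreme j)
extremes-nonadjacent m (k , x , y , xy , ex , ey)
  with extreme-preimage m x ex | extreme-preimage m y ey
... | refl , refl | refl , refl = adjacent⇒≢ m xy refl

extreme-junction-nonadjacent : ∀ m {i} → ¬ GAdj (suc m) (extreme i) (junction i)
extreme-junction-nonadjacent m (k , x , y , _ , ex , ey) with extreme-preimage m x ex
... | refl , _ = junction-not-in-own-copy m y ey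

fresh : (k j : Fin 3) → ∃[ l ] l ≢ k × l ≢ j
fresh 0F 0F = 1F , (λ ()) , (λ ())
fresh 0F 1F = 2F , (λ ()) , (λ ())
fresh 0F 2F = 1F , (λ ()) , (λ ())
fresh 1F 0F = 2F , (λ ()) , (λ ())
fresh 1F 1F = 0F , (λ ()) , (λ ())
fresh 1F 2F = 0F , (λ ()) , (λ ())
fresh 2F 0F = 1F , (λ ()) , (λ ())
fresh 2F 1F = 0F , (λ ()) , (λ ())
fresh 2F 2F = 0F , (λ ()) , (λ ())

extreme-junction-adjacent : ∀ {i j} → i ≢ j → GAdj 1 (extreme i) (junction j)
extreme-junction-adjacent {0F} {0F} i≢j = ⊥-elim (i≢j refl)
extreme-junction-adjacent {0F} {1F} _   = 0F , extreme 0F , extreme 2F , (λ ()) , refl , refl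
extreme-junction-adjacent {0F} {2F} _   = 0F , extreme 0F , extreme 1F , (λ ()) , refl , refl
extreme-junction-adjacent {1F} {0F} _   = 1F , extreme 1F , extreme 2F , (λ ()) , refl , refl
extreme-junction-adjacent {1F} {1F} i≢j = ⊥-elim (i≢j refl)
extreme-junction-adjacent {1F} {2F} _   = 1F , extreme 1F , extreme 0F , (λ ()) , refl , refl
extreme-junction-adjacent {2F} {0F} _   = 2F , extreme 2F , extreme 1F , (λ ()) , refl , refl
extreme-junction-adjacent {2F} {1F} _   = 2F , extreme 2F , extreme 0F , (λ ()) , refl , refl
extreme-junction-adjacent {2F} {2F} i≢j = ⊥-elim (i≢j refl)

extremesBut : Fin 3 → List (Vtx 1)
extremesBut 0F = extreme 1F ∷ extreme 2F ∷ []
extremesBut 1F = extreme 0F ∷ extreme 2F ∷ []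
extremesBut 2F = extreme 0F ∷ extreme 1F ∷ []

∈-extremesBut : ∀ {i k} → i ≢ k → extreme i ∈ extremesBut k
∈-extremesBut {0F} {0F} i≢k = ⊥-elim (i≢k refl)
∈-extremesBut {1F} {0F} _   = here refl
∈-extremesBut {2F} {0F} _   = there (here refl)
∈-extremesBut {0F} {1F} _   = here refl
∈-extremesBut {1F} {1F} i≢k = ⊥-elim (i≢k refl)
∈-extremesBut {2F} {1F} _   = there (here refl)
∈-extremesBut {0F} {2F} _   = here refl
∈-extremesBut {1F} {2F} _   = there (here refl)
∈-extremesBut {2F} {2F} i≢k = ⊥-elim (i≢k refl)

extreme-junction-covered : ∀ k {i j} → GAdj 1 (extreme i) (junction j) →
  CoveredBy (Gasket 1) (extremesBut k) (extreme i) (junction j)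
extreme-junction-covered k {i} {j} a with i ≟ k
... | no i≢k = covered-from-endpoint (∈-extremesBut i≢k) a (adjacent⇒≢ 1 a)
... | yes refl with fresh i j
...   | l , l≢i , l≢j = covered-sym (covered-from-neighbour (∈-extremesBut l≢i)
          (extreme-junction-adjacent l≢j) (adjacent-sym 1 a)
          (l≢i ∘ inj₁-injective) (extremes-nonadjacent 0))

junction-junction-covered : ∀ k {i j} → GAdj 1 (junction i) (junction j) →
  CoveredBy (Gasket 1) (extremesBut k) (junction i) (junction j)
junction-junction-covered k {i} {j} a with i ≟ k
... | no i≢k = covered-sym (covered-from-neighbour (∈-extremesBut i≢k)
          (extreme-junction-adjacent (adjacent⇒≢ 1 a ∘ cong junction)) (adjacent-sym 1 a)
          (λ ()) (extreme-junction-nonadjacent 0))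
... | yes refl = covered-from-neighbour (∈-extremesBut j≢i)
          (extreme-junction-adjacent j≢i) a (λ ()) (extreme-junction-nonadjacent 0)
  where j≢i = adjacent⇒≢ 1 (adjacent-sym 1 a) ∘ cong junction

S₂-covered : ∀ k → Is2SPUCover (Gasket 1) (extremesBut k)
S₂-covered k (extreme i)  (extreme j)  a = ⊥-elim (extremes-nonadjacent 0 a)
S₂-covered k (extreme i)  (junction j) a = extreme-junction-covered k a
S₂-covered k (junction i) (extreme j)  a = covered-sym (extreme-junction-covered k (adjacent-sym 1 a))
S₂-covered k (junction i) (junction j) a = junction-junction-covered k a
S₂-covered k (inj₂ (inj₂ (_ , ()))) _ _
S₂-covered k _ (inj₂ (inj₂ (_ , ()))) _

junctions : List (Vtx 2)
junctions = map (λ t → junction t) (allFin 3)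

junction-∈-junctions : ∀ t → junction t ∈ junctions
junction-∈-junctions t = ∈-map⁺ (λ t → junction t) (∈-allFin t)

extremesBut-onto-junctions : ∀ k {u} → u ∈ extremesBut k → emb 1 k u ∈ junctions
extremesBut-onto-junctions 0F (here refl)         = junction-∈-junctions _
extremesBut-onto-junctions 0F (there (here refl)) = junction-∈-junctions _
extremesBut-onto-junctions 1F (here refl)         = junction-∈-junctions _
extremesBut-onto-junctions 1F (there (here refl)) = junction-∈-junctions _
extremesBut-onto-junctions 2F (here refl)         = junction-∈-junctions _
extremesBut-onto-junctions 2F (there (here refl)) = junction-∈-junctions _

inAllCopies : ∀ m → List (Vtx m) → List (Vtx (suc m))
inAllCopies m S = map (emb m 0F) S ++ map (emb m 1F) S ++ map (emb m 2F) S

∈-inAllCopies : ∀ m k {S u} → u ∈ S → emb m k u ∈ inAllCopies m S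
∈-inAllCopies m 0F u∈S = ∈-++⁺ˡ (∈-map⁺ (emb m 0F) u∈S)
∈-inAllCopies m 1F {S} u∈S = ∈-++⁺ʳ (map (emb m 0F) S) (∈-++⁺ˡ (∈-map⁺ (emb m 1F) u∈S))
∈-inAllCopies m 2F {S} u∈S =
  ∈-++⁺ʳ (map (emb m 0F) S) (∈-++⁺ʳ (map (emb m 1F) S) (∈-map⁺ (emb m 2F) u∈S))

length-inAllCopies : ∀ m S → length (inAllCopies m S) ≡ 3 * length S
length-inAllCopies m S = begin
  length (map (emb m 0F) S ++ map (emb m 1F) S ++ map (emb m 2F) S)
    ≡⟨ length-++ (map (emb m 0F) S) ⟩
  length (map (emb m 0F) S) + length (map (emb m 1F) S ++ map (emb m 2F) S)
    ≡⟨ cong (length (map (emb m 0F) S) +_) (length-++ (map (emb m 1F) S)) ⟩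
  length (map (emb m 0F) S) + (length (map (emb m 1F) S) + length (map (emb m 2F) S))
    ≡⟨ cong₂ _+_ (length-map (emb m 0F) S)
         (cong₂ _+_ (length-map (emb m 1F) S) (trans (length-map (emb m 2F) S) (sym (+-identityʳ _)))) ⟩
  3 * length S
    ∎
  where open ≡-Reasoning

gasketCover : ∀ p → List (Vtx (suc (suc p)))
gasketCover zero    = junctions
gasketCover (suc p) = inAllCopies (suc (suc p)) (gasketCover p)

gasketCover-covers : ∀ p → Is2SPUCover (Gasket (suc (suc p))) (gasketCover p)
gasketCover-covers zero =
  gasket-cover-from-copies 1 extremesBut junctions S₂-covered extremesBut-onto-junctions
gasketCover-covers (suc p) =
  gasket-cover-from-copies (suc (suc p)) (λ _ → gasketCover p) (gasketCover (suc p))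
    (λ _ → gasketCover-covers p) (λ k → ∈-inAllCopies (suc (suc p)) k)

length-gasketCover : ∀ p → length (gasketCover p) ≡ 3 ^ suc p
length-gasketCover zero    = refl
length-gasketCover (suc p) =
  trans (length-inAllCopies (suc (suc p)) (gasketCover p)) (cong (3 *_) (length-gasketCover p))

mainTheorem16 : ∀ (n : ℕ) → 3 ≤ n → SPC2U≤ (S n) (3 ^ (n ∸ 2))
mainTheorem16 (suc (suc (suc p))) _ =
  gasketCover p , ≤-reflexive (length-gasketCover p) , gasketCover-covers p
mainTheorem16 (suc zero)       (s≤s ())
mainTheorem16 (suc (suc zero)) (s≤s (s≤s ()))
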